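{- Let $H$ be a bipartite graph and let $n>v(H)$ be an integer. Then for every positive integer $m$, $$\tilde{r}(H,P_m)\le \left\lceil\frac{m}{n-v(H)}\right\rceil\bigl(\tilde{r}(H,P_n)+e(H)\bigr),$$ where $v(H)$ and $e(H)$ denote the numbers of vertices and edges of $H$.
   Context: $P_k$ denotes the path on $k$ vertices. For graphs $H_1,H_2$, the online Ramsey game is played on the edge set of the infinite complete graph $K_{\mathbb N}$ (vertex set $\mathbb N$), starting with no colored edges. In every round Builder selects a previously unselected edge and Painter colors it red or blue. The game ends as soon as, after a move of Painter, there is a red copy of $H_1$ or a blue copy of $H_2$. Builder tries to end the game as soon as possible, Painter tries to delay it. The online size Ramsey number $\tilde{r}(H_1,H_2)$ is the number of rounds of the game when both players play optimally. -}

module Defs where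

open import Data.Nat using (ℕ; zero; suc; _+_; _*_; _∸_; _<_; _≡ᵇ_; NonZero; >-nonZero)
open import Data.Nat.Properties using (m<n⇒0<n∸m)
open import Data.Nat.DivMod using (_/_)
open import Data.Bool using (Bool; true; false; _∨_; _∧_; if_then_else_)
open import Data.Bool.Properties using (∨-comm)
open import Data.Fin using (Fin; toℕ; _<?_)
open import Data.List using (List; []; _∷_; map; allFin; cartesianProduct)
open import Data.Nat.ListAction using (sum)
open import Data.List.Membership.Propositional using (_∈_)
open import Data.Product using (Σ; _×_; _,_)
open import Data.Sum using (_⊎_)
open import Data.Empty using (⊥)
open import Relation.Nullary using (¬_)
open import Relation.Nullary.Decidable using (⌊_⌋)
open import Relation.Binary.PropositionalEquality using (_≡_; _≢_; refl)
open import Function.Definitions using (Injective)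

record Graph : Set where
  field
    v    : ℕ
    adj  : Fin v → Fin v → Bool
    sym  : ∀ i j → adj i j ≡ adj j i
    irr  : ∀ i → adj i i ≡ false
open Graph public

e : Graph → ℕ
e H = sum (map (λ { (i , j) → if ⌊ i <? j ⌋ ∧ adj H i j then 1 else 0 })
               (cartesianProduct (allFin (v H)) (allFin (v H))))

Bipartite : Graph → Set
Bipartite H = Σ (Fin (v H) → Bool) λ f →
  ∀ i j → adj H i j ≡ true → f i ≢ f j

private
  suc≢ : ∀ n → (suc n ≡ᵇ n) ≡ false
  suc≢ zero = refl
  suc≢ (suc n) = suc≢ n

  pathAdj : ∀ k → Fin k → Fin k → Bool
  pathAdj k i j = (suc (toℕ i) ≡ᵇ toℕ j) ∨ (suc (toℕ j) ≡ᵇ toℕ i)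

  pathIrr : ∀ k (i : Fin k) → pathAdj k i i ≡ false
  pathIrr k i rewrite suc≢ (toℕ i) = refl

P : ℕ → Graph
P k = record
  { v = k
  ; adj = pathAdj k
  ; sym = λ i j → ∨-comm (suc (toℕ i) ≡ᵇ toℕ j) (suc (toℕ j) ≡ᵇ toℕ i)
  ; irr = pathIrr k
  }

data Colour : Set where
  red blue : Colour

-- a game state: the list of coloured edges so far, an edge {a,b}
-- recorded as (a , b , colour)
State : Set
State = List (ℕ × ℕ × Colour)

Coloured : State → ℕ → ℕ → Colour → Set
Coloured s a b c = ((a , b , c) ∈ s) ⊎ ((b , a , c) ∈ s)

Unselected : State → ℕ → ℕ → Set
Unselected s a b = ∀ c → ¬ Coloured s a b c

HasCopy : Graph → Colour → State → Set
HasCopy H c s = Σ (Fin (v H) → ℕ) λ φ →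
  Injective _≡_ _≡_ φ × (∀ i j → adj H i j ≡ true → Coloured s (φ i) (φ j) c)

Ended : Graph → Graph → State → Set
Ended H₁ H₂ s = HasCopy H₁ red s ⊎ HasCopy H₂ blue s

BuilderWins : Graph → Graph → ℕ → State → Set
BuilderWins H₁ H₂ zero    s = ⊥
BuilderWins H₁ H₂ (suc k) s = Σ ℕ λ a → Σ ℕ λ b →
  a ≢ b × Unselected s a b ×
  (∀ c → Ended H₁ H₂ ((a , b , c) ∷ s) ⊎ BuilderWins H₁ H₂ k ((a , b , c) ∷ s))

IsOnlineRamsey : Graph → Graph → ℕ → Set
IsOnlineRamsey H₁ H₂ r =
  BuilderWins H₁ H₂ r [] × (∀ k → k < r → ¬ BuilderWins H₁ H₂ k [])

⌈_/_⌉ : (m d : ℕ) → .{{NonZero d}} → ℕ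
⌈ m / d ⌉ = (m + d ∸ 1) / d

gap-nonZero : ∀ {a n} → a < n → NonZero (n ∸ a)
gap-nonZero lt = >-nonZero (m<n⇒0<n∸m lt)

{-# OPTIONS --safe #-}
module Submission where

-- Builder grows a blue path in stages. First he plays a winning (H, P_n)-strategy: it
-- produces a red H, or a blue path on n vertices. Given a blue path α on L ≥ v(H)
-- vertices, he plays that strategy again on fresh vertices, producing a red H or a
-- fresh blue path β on n vertices, and then asks for the e(H) edges of a copy of H in
-- which one side of the bipartition sits on the last vertices of α and the other on the
-- first vertices of β, each side ordered by rank. If all of them are red there is a red
-- H. Otherwise some blue edge joins the a-th last vertex of α to the b-th vertex of β
-- (counting from 0) with a + b ≤ v(H) − 2, and α up to that vertex followed by β from
-- the other one is a blue path on at least L + n − v(H) vertices. Each stage costs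
-- r̃(H,P_n) + e(H) rounds, and ⌈m / (n − v(H))⌉ − 1 stages after the first one the path
-- has at least m vertices.

open import Defs
open import Data.Nat using (ℕ; _+_; _*_; _∸_; _≤_; _<_)
open import Data.Nat as ℕ using (zero; suc; z≤n; s≤s; s≤s⁻¹; NonZero)
open import Data.Nat.Properties
open import Data.Nat.DivMod using (_/_; _%_; m≡m%n+[m/n]*n; m%n<n)
open import Data.Nat.ListAction using (sum)
open import Algebra.Properties.CommutativeSemigroup +-commutativeSemigroup
  using (xy∙z≈xz∙y; xy∙z≈zx∙y)
open import Data.Bool using (Bool; true; false; not; _∧_; if_then_else_)
open import Data.Bool.Properties using (T-≡; T-∨; T-∧)
open import Data.Fin using (Fin; toℕ; fromℕ<)
open import Data.Fin.Properties using (toℕ<n; toℕ-fromℕ<; fromℕ<-toℕ; toℕ-injective)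
import Data.Fin.Properties as Fin
open import Data.List using (List; []; _∷_; _++_; map; length; filterᵇ; allFin; cartesianProduct)
open import Data.List.Properties using (length-map)
open import Data.List.Membership.Propositional using (_∈_; find)
open import Data.List.Membership.Propositional.Properties
  using (∈-++⁻; ∈-++⁺ˡ; ∈-map⁺; ∈-map⁻; ∈-filter⁺; ∈-filter⁻; ∈-cartesianProduct⁺; ∈-allFin)
import Data.List.Membership.DecPropositional as DecMembership
open import Data.List.Relation.Binary.Subset.Propositional using (_⊆_)
open import Data.List.Relation.Binary.Subset.Propositional.Properties
  using (⊆-refl; ⊆-trans; xs⊆x∷xs; xs⊆ys++xs)
open import Data.List.Relation.Unary.Any using (Any; here; there)
import Data.List.Relation.Unary.Any.Properties as Any
open import Data.List.Relation.Unary.All using (All; []; _∷_)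
import Data.List.Relation.Unary.All as All
import Data.List.Relation.Unary.All.Properties as All
open import Data.Product using (Σ; ∃; _×_; _,_; proj₁; proj₂; uncurry)
import Data.Product as Product
open import Data.Product.Properties using (≡-dec)
open import Data.Sum using (_⊎_; inj₁; inj₂; [_,_]′)
import Data.Sum as Sum
open import Function using (_∘_)
open import Function.Bundles using (Equivalence)
open import Function.Definitions using (Injective)
open import Relation.Binary.Definitions using (DecidableEquality; tri<; tri≈; tri>)
open import Relation.Binary.PropositionalEquality
  using (_≡_; _≢_; refl; trans; cong; cong₂; subst; subst₂; module ≡-Reasoning)
import Relation.Binary.PropositionalEquality as ≡
open import Relation.Nullary using (Dec; yes; no; contradiction)
open import Relation.Nullary.Decidable using (⌊_⌋; _⊎-dec_; fromWitness; T?)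

data Forces (Q : State → Set) : ℕ → State → Set where
  done : ∀ {k s} → Q s → Forces Q k s
  move : ∀ {k s} a b → a ≢ b → Unselected s a b →
         (∀ c → Forces Q k ((a , b , c) ∷ s)) → Forces Q (suc k) s

forces-≤ : ∀ {Q k j s} → k ≤ j → Forces Q k s → Forces Q j s
forces-≤ _         (done q)                 = done q
forces-≤ (s≤s k≤j) (move a b a≢b free next) = move a b a≢b free (forces-≤ k≤j ∘ next)

forces-map : ∀ {Q R : State → Set} {k s} → (∀ {t} → Q t → R t) → Forces Q k s → Forces R k s
forces-map g (done q)                 = done (g q)
forces-map g (move a b a≢b free next) = move a b a≢b free (forces-map g ∘ next)

forces-extends : ∀ {Q k s} → Forces Q k s → Forces (λ t → Q t × s ⊆ t) k s
forces-extends (done q) = done (q , ⊆-refl)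
forces-extends {s = s} (move a b a≢b free next) = move a b a≢b free λ c →
  forces-map (Product.map₂ (⊆-trans (xs⊆x∷xs s _))) (forces-extends (next c))

forces-bind : ∀ {Q R k j s} → Forces Q k s → (∀ {t} → Q t → Forces R j t) → Forces R (k + j) s
forces-bind {k = k} {j} (done q) g = forces-≤ (m≤n+m j k) (g q)
forces-bind (move a b a≢b free next) g = move a b a≢b free λ c → forces-bind (next c) g

coloured-⊆ : ∀ {s t a b c} → s ⊆ t → Coloured s a b c → Coloured t a b c
coloured-⊆ s⊆t = Sum.map s⊆t s⊆t

coloured-sym : ∀ {s a b c} → Coloured s a b c → Coloured s b a c
coloured-sym = Sum.swap

hasCopy-⊆ : ∀ {G c s t} → s ⊆ t → HasCopy G c s → HasCopy G c t
hasCopy-⊆ s⊆t (φ , φ-inj , edge) = φ , φ-inj , λ i j ij → coloured-⊆ s⊆t (edge i j ij)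

ended-⊆ : ∀ {H₁ H₂ s t} → s ⊆ t → Ended H₁ H₂ s → Ended H₁ H₂ t
ended-⊆ {H₁} {H₂} s⊆t = Sum.map (hasCopy-⊆ {H₁} s⊆t) (hasCopy-⊆ {H₂} s⊆t)

forces⇒ended⊎wins : ∀ {H₁ H₂ k s} → Forces (Ended H₁ H₂) k s →
                    Ended H₁ H₂ s ⊎ BuilderWins H₁ H₂ k s
forces⇒ended⊎wins (done ended) = inj₁ ended
forces⇒ended⊎wins (move a b a≢b free next) =
  inj₂ (a , b , a≢b , free , forces⇒ended⊎wins ∘ next)

forces⇒wins : ∀ {H₁ H₂ k} → 1 ≤ k → Forces (Ended H₁ H₂) k [] → BuilderWins H₁ H₂ k []
forces⇒wins {H₁} {H₂} {suc k} _ forces with forces⇒ended⊎wins forces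
... | inj₂ wins  = wins
-- The empty board is already Ended when H₁ or H₂ has no edges, but BuilderWins
-- counts at least one round.
... | inj₁ ended = 0 , 1 , (λ ()) , (λ _ → λ { (inj₁ ()) ; (inj₂ ()) }) ,
                   λ c → inj₁ (ended-⊆ {H₁} {H₂} (xs⊆x∷xs [] _) ended)

wins-positive : ∀ {H₁ H₂ k s} → BuilderWins H₁ H₂ k s → 1 ≤ k
wins-positive {k = suc _} _ = s≤s z≤n

ramsey-≤ : ∀ {H₁ H₂ r k} → IsOnlineRamsey H₁ H₂ r → BuilderWins H₁ H₂ k [] → r ≤ k
ramsey-≤ (_ , minimal) wins = ≮⇒≥ λ k<r → minimal _ k<r wins

_≟ᶜ_ : DecidableEquality Colour
red  ≟ᶜ red  = yes refl
red  ≟ᶜ blue = no λ ()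
blue ≟ᶜ red  = no λ ()
blue ≟ᶜ blue = yes refl

coloured? : ∀ s a b c → Dec (Coloured s a b c)
coloured? s a b c = ((a , b , c) ∈? s) ⊎-dec ((b , a , c) ∈? s)
  where open DecMembership (≡-dec ℕ._≟_ (≡-dec ℕ._≟_ _≟ᶜ_))

-- Playing a strategy on shifted vertices

shiftEdge : ℕ → ℕ × ℕ × Colour → ℕ × ℕ × Colour
shiftEdge N (a , b , c) = N + a , N + b , c

shift : ℕ → State → State
shift N = map (shiftEdge N)

shiftEdge-injective : ∀ N {x y} → shiftEdge N x ≡ shiftEdge N y → x ≡ y
shiftEdge-injective N {a , b , c} {a′ , b′ , c′} eq
  with +-cancelˡ-≡ N a a′ (cong proj₁ eq) | +-cancelˡ-≡ N b b′ (cong (proj₁ ∘ proj₂) eq)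
     | cong (proj₂ ∘ proj₂) eq
... | refl | refl | refl = refl

Below : ℕ → State → Set
Below N s = ∀ {a b c} → (a , b , c) ∈ s → a < N × b < N

unshift : ∀ {N s t′ a b c} → Below N s → (N + a , N + b , c) ∈ shift N t′ ++ s →
          (a , b , c) ∈ t′
unshift {N} {a = a} below e∈ with ∈-++⁻ (shift _ _) e∈
... | inj₂ e∈s = contradiction (proj₁ (below e∈s)) (m+n≮m N a)
... | inj₁ e∈shifted with ∈-map⁻ (shiftEdge N) e∈shifted
...   | _ , e′∈t′ , eq = subst (_∈ _) (≡.sym (shiftEdge-injective N eq)) e′∈t′

coloured-shift : ∀ {N s t′ a b c} → Coloured t′ a b c →
                 Coloured (shift N t′ ++ s) (N + a) (N + b) c
coloured-shift {N} = Sum.map (∈-++⁺ˡ ∘ ∈-map⁺ (shiftEdge N)) (∈-++⁺ˡ ∘ ∈-map⁺ (shiftEdge N))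

hasCopy-shift : ∀ {G c N s t′} → HasCopy G c t′ → HasCopy G c (shift N t′ ++ s)
hasCopy-shift {N = N} (φ , φ-inj , edge) =
  (N +_) ∘ φ , (λ eq → φ-inj (+-cancelˡ-≡ N _ _ eq)) , λ i j ij → coloured-shift (edge i j ij)

PlayedAbove : Graph → Graph → ℕ → State → State → Set
PlayedAbove H₁ H₂ N s t = ∃ λ t′ → t ≡ shift N t′ ++ s × Ended H₁ H₂ t′

forces-shifted : ∀ {H₁ H₂ N s k t′} → Below N s → BuilderWins H₁ H₂ k t′ →
                 Forces (PlayedAbove H₁ H₂ N s) k (shift N t′ ++ s)
forces-shifted {N = N} {s} {suc k} {t′} below (a , b , a≢b , free , next) =
  move (N + a) (N + b) (a≢b ∘ +-cancelˡ-≡ N a b) free′ λ c →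
    [ (λ ended → done (_ , refl , ended)) , forces-shifted below ]′ (next c)
  where
  free′ : Unselected (shift N t′ ++ s) (N + a) (N + b)
  free′ c = free c ∘ Sum.map (unshift below) (unshift below)

stateBound : State → ℕ
stateBound []                = 0
stateBound ((a , b , _) ∷ s) = suc (a + b) + stateBound s

below-stateBound : ∀ s → Below (stateBound s) s
below-stateBound ((a , b , _) ∷ s) (here refl) =
  below-head (m≤m+n a b) , below-head (m≤n+m b a)
  where
  below-head : ∀ {x} → x ≤ a + b → x < suc (a + b) + stateBound s
  below-head x≤a+b = ≤-trans (s≤s x≤a+b) (m≤m+n _ _)
below-stateBound ((a , b , _) ∷ s) (there e∈s) =
  Product.map below-tail below-tail (below-stateBound s e∈s)
  where
  below-tail : ∀ {x} → x < stateBound s → x < suc (a + b) + stateBound s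
  below-tail x< = ≤-trans x< (m≤n+m _ _)

below-≤ : ∀ {N N′ s} → N ≤ N′ → Below N s → Below N′ s
below-≤ N≤N′ below e∈s =
  Product.map (λ a<N → <-≤-trans a<N N≤N′) (λ b<N → <-≤-trans b<N N≤N′) (below e∈s)

-- Blue paths

InjectiveBelow : ℕ → (ℕ → ℕ) → Set
InjectiveBelow L α = ∀ {i j} → i < L → j < L → α i ≡ α j → i ≡ j

BlueSteps : State → ℕ → (ℕ → ℕ) → Set
BlueSteps t L α = ∀ {k} → suc k < L → Coloured t (α k) (α (suc k)) blue

record BluePath (t : State) (L : ℕ) (α : ℕ → ℕ) : Set where
  field
    injective   : InjectiveBelow L α
    consecutive : BlueSteps t L α
open BluePath

Apart : ℕ → (ℕ → ℕ) → (ℕ → ℕ) → Set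
Apart L α β = ∀ {i j} → i < L → α i ≢ β j

apart-bound : ∀ {L N α β} → (∀ {i} → i < L → α i < N) → (∀ j → N ≤ β j) → Apart L α β
apart-bound {N = N} α<N N≤β {j = j} i<L eq =
  <⇒≱ (α<N i<L) (subst (N ≤_) (≡.sym eq) (N≤β j))

pathBound : ℕ → (ℕ → ℕ) → ℕ
pathBound zero    α = 0
pathBound (suc L) α = suc (α L) + pathBound L α

pathBound-> : ∀ {L α k} → k < L → α k < pathBound L α
pathBound-> {suc L} (s≤s k≤L) with m≤n⇒m<n∨m≡n k≤L
... | inj₁ k<L  = ≤-trans (pathBound-> k<L) (m≤n+m _ _)
... | inj₂ refl = m≤m+n _ _

bluePath-⊆ : ∀ {s t L α} → s ⊆ t → BluePath s L α → BluePath t L α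
bluePath-⊆ s⊆t p = record
  { injective   = injective p
  ; consecutive = coloured-⊆ s⊆t ∘ consecutive p
  }

bluePath-take : ∀ {t L L′ α} → L′ ≤ L → BluePath t L α → BluePath t L′ α
bluePath-take L′≤L p = record
  { injective   = λ i<L′ j<L′ → injective p (<-≤-trans i<L′ L′≤L) (<-≤-trans j<L′ L′≤L)
  ; consecutive = λ k<L′ → consecutive p (<-≤-trans k<L′ L′≤L)
  }

bluePath-drop : ∀ {t n b β} → BluePath t (n + b) β → BluePath t n (λ k → β (k + b))
bluePath-drop {b = b} p = record
  { injective   = λ i<n j<n eq →
      +-cancelʳ-≡ b _ _ (injective p (+-monoˡ-< b i<n) (+-monoˡ-< b j<n) eq)
  ; consecutive = λ k<n → consecutive p (+-monoˡ-< b k<n)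
  }

bluePath-shift : ∀ {N s t′ L α} → BluePath t′ L α → BluePath (shift N t′ ++ s) L ((N +_) ∘ α)
bluePath-shift {N} p = record
  { injective   = λ i<L j<L eq → injective p i<L j<L (+-cancelˡ-≡ N _ _ eq)
  ; consecutive = coloured-shift ∘ consecutive p
  }

join : ℕ → (ℕ → ℕ) → (ℕ → ℕ) → ℕ → ℕ
join zero    α β         = β
join (suc L) α β zero    = α zero
join (suc L) α β (suc k) = join L (α ∘ suc) β k

join-< : ∀ {L k α β} → k < L → join L α β k ≡ α k
join-< {suc L} {zero}          _         = refl
join-< {suc L} {suc k} {α} {β} (s≤s k<L) = join-< {L} {k} {α ∘ suc} {β} k<L

join-+ : ∀ L {α β k} → join L α β (L + k) ≡ β k
join-+ zero        = refl
join-+ (suc L) {α} = join-+ L {α ∘ suc}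

data Split (L : ℕ) : ℕ → Set where
  left  : ∀ {k} → k < L → Split L k
  right : ∀ k → Split L (L + k)

split : ∀ L k → Split L k
split zero    k       = right k
split (suc L) zero    = left (s≤s z≤n)
split (suc L) (suc k) with split L k
... | left k<L = left (s≤s k<L)
... | right k′ = right k′

join-injective : ∀ {L n α β} → InjectiveBelow L α → InjectiveBelow n β → Apart L α β →
                 InjectiveBelow (L + n) (join L α β)
join-injective {L} {n} {α} {β} α-inj β-inj apart {i} {j} i<L+n j<L+n eq
  with split L i | split L j
... | left i<L | left j<L =
  α-inj i<L j<L (trans (≡.sym (join-< i<L)) (trans eq (join-< j<L)))
... | left i<L | right _ =
  contradiction (trans (≡.sym (join-< i<L)) (trans eq (join-+ L))) (apart i<L)
... | right _  | left j<L =
  contradiction (trans (≡.sym (join-< j<L)) (trans (≡.sym eq) (join-+ L))) (apart j<L)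
... | right i′ | right j′ =
  cong (L +_) (β-inj (+-cancelˡ-< L i′ n i<L+n) (+-cancelˡ-< L j′ n j<L+n)
                     (trans (≡.sym (join-+ L)) (trans eq (join-+ L))))

join-consecutive : ∀ {t n} p {α β} → BlueSteps t (suc p) α → BlueSteps t n β →
                   Coloured t (α p) (β 0) blue → BlueSteps t (suc p + n) (join (suc p) α β)
join-consecutive zero    α-steps β-steps αp-β0 {zero}  _           = αp-β0
join-consecutive zero    α-steps β-steps αp-β0 {suc k} (s≤s k<1+n) = β-steps k<1+n
join-consecutive (suc p) α-steps β-steps αp-β0 {zero}  _           = α-steps (s≤s (s≤s z≤n))
join-consecutive (suc p) α-steps β-steps αp-β0 {suc k} (s≤s k<)    =
  join-consecutive p (α-steps ∘ s≤s) β-steps αp-β0 k<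

bluePath-join : ∀ {t n p α β} → Apart (suc p) α β → BluePath t (suc p) α → BluePath t n β →
                Coloured t (α p) (β 0) blue → BluePath t (suc p + n) (join (suc p) α β)
bluePath-join {p = p} apart pα pβ αp-β0 = record
  { injective   = join-injective (injective pα) (injective pβ) apart
  ; consecutive = join-consecutive p (consecutive pα) (consecutive pβ) αp-β0
  }

bluePath-glue : ∀ {t L n p b α β} → Apart L α β → BluePath t L α → BluePath t n β →
                p < L → b < n → Coloured t (α p) (β b) blue →
                BluePath t (suc p + (n ∸ b)) (join (suc p) α (λ k → β (k + b)))
bluePath-glue {t} {β = β} apart pα pβ p<L b<n αp-βb = bluePath-join
  (λ i<1+p → apart (<-≤-trans i<1+p p<L))
  (bluePath-take p<L pα)
  (bluePath-drop (subst (λ L → BluePath t L β) (≡.sym (m∸n+n≡m (<⇒≤ b<n))) pβ))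
  αp-βb

glue-length : ∀ {L n V a b} → a < L → V ≤ n → suc a + suc b ≤ V →
              L + (n ∸ V) ≤ suc (L ∸ suc a) + (n ∸ b)
glue-length {L} {n} {V} {a} {b} a<L V≤n a+b+2≤V = begin
  L + (n ∸ V)                     ≡⟨ cong (_+ (n ∸ V)) (m∸n+n≡m a<L) ⟨
  L ∸ suc a + suc a + (n ∸ V)     ≡⟨ +-assoc (L ∸ suc a) (suc a) (n ∸ V) ⟩
  L ∸ suc a + suc (a + (n ∸ V))   ≤⟨ +-monoʳ-≤ (L ∸ suc a) (s≤s a+gap≤n∸b) ⟩
  L ∸ suc a + suc (n ∸ b)         ≡⟨ +-suc (L ∸ suc a) (n ∸ b) ⟩
  suc (L ∸ suc a) + (n ∸ b)       ∎
  where
  open ≤-Reasoning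
  a+b≤V : a + b ≤ V
  a+b≤V = ≤-trans (+-mono-≤ (n≤1+n a) (n≤1+n b)) a+b+2≤V
  a+gap≤n∸b : a + (n ∸ V) ≤ n ∸ b
  a+gap≤n∸b = m+n≤o⇒m≤o∸n (a + (n ∸ V)) (begin
    a + (n ∸ V) + b   ≡⟨ xy∙z≈xz∙y a (n ∸ V) b ⟩
    a + b + (n ∸ V)   ≤⟨ +-monoˡ-≤ (n ∸ V) a+b≤V ⟩
    V + (n ∸ V)       ≡⟨ m+[n∸m]≡n V≤n ⟩
    n                 ∎)

extend : ∀ {n} {A : Set} → A → (Fin n → A) → ℕ → A
extend {n} a φ k with k ℕ.<? n
... | yes k<n = φ (fromℕ< k<n)
... | no  _   = a

extend-fromℕ< : ∀ {n} {A : Set} {a : A} {φ : Fin n → A} {k} (k<n : k < n) →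
                extend a φ k ≡ φ (fromℕ< k<n)
extend-fromℕ< {n} {k = k} k<n with k ℕ.<? n
... | yes _   = refl
... | no  k≮n = contradiction k<n k≮n

extend-toℕ : ∀ {n} {A : Set} {a : A} {φ : Fin n → A} (x : Fin n) → extend a φ (toℕ x) ≡ φ x
extend-toℕ {φ = φ} x = trans (extend-fromℕ< (toℕ<n x)) (cong φ (fromℕ<-toℕ x (toℕ<n x)))

extend-injective : ∀ {n a} {φ : Fin n → ℕ} → Injective _≡_ _≡_ φ →
                   InjectiveBelow n (extend a φ)
extend-injective {φ = φ} φ-inj {i} {j} i<n j<n eq = begin
  i                 ≡⟨ toℕ-fromℕ< i<n ⟨
  toℕ (fromℕ< i<n)  ≡⟨ cong toℕ (φ-inj φ[i]≡φ[j]) ⟩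
  toℕ (fromℕ< j<n)  ≡⟨ toℕ-fromℕ< j<n ⟩
  j                 ∎
  where
  open ≡-Reasoning
  φ[i]≡φ[j] = trans (≡.sym (extend-fromℕ< i<n)) (trans eq (extend-fromℕ< j<n))

P-adjacent : ∀ {m} {i j : Fin m} → suc (toℕ i) ≡ toℕ j → adj (P m) i j ≡ true
P-adjacent {i = i} {j} eq =
  Equivalence.to T-≡ (Equivalence.from T-∨ (inj₁ (≡⇒≡ᵇ (suc (toℕ i)) (toℕ j) eq)))

P-adjacent⁻ : ∀ {m} {i j : Fin m} → adj (P m) i j ≡ true →
              suc (toℕ i) ≡ toℕ j ⊎ suc (toℕ j) ≡ toℕ i
P-adjacent⁻ ij = Sum.map (≡ᵇ⇒≡ _ _) (≡ᵇ⇒≡ _ _) (Equivalence.to T-∨ (Equivalence.from T-≡ ij))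

bluePath⇒copy : ∀ {t m L α} → m ≤ L → BluePath t L α → HasCopy (P m) blue t
bluePath⇒copy {t} {m} {L} {α} m≤L p =
  α ∘ toℕ , (λ eq → toℕ-injective (injective p (inside _) (inside _) eq)) , edge
  where
  inside : (x : Fin m) → toℕ x < L
  inside x = <-≤-trans (toℕ<n x) m≤L
  step : ∀ i j → suc (toℕ i) ≡ toℕ j → Coloured t (α (toℕ i)) (α (toℕ j)) blue
  step i j eq = subst (λ k → Coloured t (α (toℕ i)) (α k) blue) eq
                      (consecutive p (subst (_< L) (≡.sym eq) (inside j)))
  edge : ∀ i j → adj (P m) i j ≡ true → Coloured t (α (toℕ i)) (α (toℕ j)) blue
  edge i j ij = [ step i j , coloured-sym ∘ step j i ]′ (P-adjacent⁻ ij)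

copy⇒bluePath : ∀ {t n} ((φ , _) : HasCopy (P n) blue t) → BluePath t n (extend 0 φ)
copy⇒bluePath {t} (φ , φ-inj , edge) = record
  { injective   = extend-injective φ-inj
  ; consecutive = step
  }
  where
  step : BlueSteps t _ (extend 0 φ)
  step {k} k+1<n = subst₂ (λ x y → Coloured t x y blue)
    (≡.sym (extend-fromℕ< k<n)) (≡.sym (extend-fromℕ< k+1<n))
    (edge _ _ (P-adjacent (trans (cong suc (toℕ-fromℕ< k<n)) (≡.sym (toℕ-fromℕ< k+1<n)))))
    where k<n = <-trans (n<1+n k) k+1<n

count : (ℕ → Bool) → ℕ → ℕ
count g zero    = 0
count g (suc k) = if g k then suc (count g k) else count g k

count+count-not : ∀ g k → count g k + count (not ∘ g) k ≡ k
count+count-not g zero = refl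
count+count-not g (suc k) with g k
... | true  = cong suc (count+count-not g k)
... | false = trans (+-suc _ _) (cong suc (count+count-not g k))

count-≤ : ∀ g k → count g k ≤ k
count-≤ g k = subst (count g k ≤_) (count+count-not g k) (m≤m+n _ _)

count-step : ∀ g k → count g k ≤ count g (suc k)
count-step g k with g k
... | true  = n≤1+n _
... | false = ≤-refl

count-mono : ∀ g {i k} → i ≤ k → count g i ≤ count g k
count-mono g {k = zero}  z≤n = ≤-refl
count-mono g {k = suc k} i≤1+k with m≤n⇒m<n∨m≡n i≤1+k
... | inj₁ (s≤s i≤k) = ≤-trans (count-mono g i≤k) (count-step g k)
... | inj₂ refl      = ≤-refl

count-< : ∀ g {i k} → g i ≡ true → i < k → count g i < count g k
count-< g {i} gi i<k with g i | gi | count-mono g i<k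
... | .true | refl | 1+count≤ = 1+count≤

count-injective : ∀ g {i j} → g i ≡ true → g j ≡ true → count g i ≡ count g j → i ≡ j
count-injective g {i} {j} gi gj eq with <-cmp i j
... | tri< i<j _ _ = contradiction eq (<⇒≢ (count-< g gi i<j))
... | tri≈ _ i≡j _ = i≡j
... | tri> _ _ j<i = contradiction (≡.sym eq) (<⇒≢ (count-< g gj j<i))

isEdge : (H : Graph) → Fin (v H) × Fin (v H) → Bool
isEdge H (i , j) = ⌊ i Fin.<? j ⌋ ∧ adj H i j

vertexPairs : (H : Graph) → List (Fin (v H) × Fin (v H))
vertexPairs H = cartesianProduct (allFin (v H)) (allFin (v H))

edges : (H : Graph) → List (Fin (v H) × Fin (v H))
edges H = filterᵇ (isEdge H) (vertexPairs H)

length-filterᵇ : ∀ {A : Set} (p : A → Bool) xs →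
                 length (filterᵇ p xs) ≡ sum (map (λ x → if p x then 1 else 0) xs)
length-filterᵇ p []       = refl
length-filterᵇ p (x ∷ xs) with p x
... | true  = cong suc (length-filterᵇ p xs)
... | false = length-filterᵇ p xs

length-edges : ∀ H → length (edges H) ≡ e H
length-edges H = length-filterᵇ (isEdge H) (vertexPairs H)

edge-adjacent : ∀ {H i j} → (i , j) ∈ edges H → adj H i j ≡ true
edge-adjacent {H} i,j∈ = Equivalence.to T-≡
  (proj₂ (Equivalence.to T-∧ (proj₂ (∈-filter⁻ (T? ∘ isEdge H) {xs = vertexPairs H} i,j∈))))

ordered-edge : ∀ {H i j} → toℕ i < toℕ j → adj H i j ≡ true → (i , j) ∈ edges H
ordered-edge {H} {i} {j} i<j ij =
  ∈-filter⁺ (T? ∘ isEdge H) (∈-cartesianProduct⁺ (∈-allFin i) (∈-allFin j))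
            (Equivalence.from T-∧ (fromWitness i<j , Equivalence.from T-≡ ij))

adjacent⇒≢ : ∀ {H i j} → adj H i j ≡ true → i ≢ j
adjacent⇒≢ {H} {i} ij refl = contradiction (trans (≡.sym ij) (irr H i)) λ ()

adjacent⇒edge : ∀ {H i j} → adj H i j ≡ true → (i , j) ∈ edges H ⊎ (j , i) ∈ edges H
adjacent⇒edge {H} {i} {j} ij with Fin.<-cmp i j
... | tri< i<j _ _ = inj₁ (ordered-edge {H} i<j ij)
... | tri≈ _ i≡j _ = contradiction i≡j (adjacent⇒≢ {H} ij)
... | tri> _ _ j<i = inj₂ (ordered-edge {H} j<i (trans (Graph.sym H j i) ij))

edge-sides : ∀ {H} ((side , _) : Bipartite H) {i j} → adj H i j ≡ true →
             side i ≡ true × side j ≡ false ⊎ side i ≡ false × side j ≡ true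
edge-sides (side , proper) {i} {j} ij with side i in si | side j in sj
... | true  | false = inj₁ (refl , refl)
... | false | true  = inj₂ (refl , refl)
... | true  | true  = contradiction (trans si (≡.sym sj)) (proper i j ij)
... | false | false = contradiction (trans si (≡.sym sj)) (proper i j ij)

ColouredPair : Colour → State → ℕ × ℕ → Set
ColouredPair c t (a , b) = Coloured t a b c

SomeBlueOrAllRed : List (ℕ × ℕ) → State → Set
SomeBlueOrAllRed ps t = Any (ColouredPair blue t) ps ⊎ All (ColouredPair red t) ps

someBlueOrAllRed-∷ : ∀ {s t a b ps} → Coloured s a b red → SomeBlueOrAllRed ps t × s ⊆ t →
                     SomeBlueOrAllRed ((a , b) ∷ ps) t
someBlueOrAllRed-∷ ab (inj₁ some , _)   = inj₁ (there some)
someBlueOrAllRed-∷ ab (inj₂ all , s⊆t) = inj₂ (coloured-⊆ s⊆t ab ∷ all)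

forces-someBlueOrAllRed : ∀ ps → All (λ (a , b) → a ≢ b) ps → ∀ s →
                          Forces (SomeBlueOrAllRed ps) (length ps) s
forces-someBlueOrAllRed []             []               s = done (inj₂ [])
forces-someBlueOrAllRed ((a , b) ∷ ps) (a≢b ∷ distinct) s
  with coloured? s a b blue | coloured? s a b red
... | yes ab-blue | _ = done (inj₁ (here ab-blue))
... | no _ | yes ab-red = forces-≤ (n≤1+n _) (forces-map (someBlueOrAllRed-∷ ab-red)
                            (forces-extends (forces-someBlueOrAllRed ps distinct s)))
... | no ab-not-blue | no ab-not-red = move a b a≢b free λ where
    blue → done (inj₁ (here (inj₁ (here refl))))
    red  → forces-map (someBlueOrAllRed-∷ (inj₁ (here refl)))
                      (forces-extends (forces-someBlueOrAllRed ps distinct _))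
  where
  free : Unselected s a b
  free red  = ab-not-red
  free blue = ab-not-blue

-- One stage: embedding H across two blue paths

RedOrPath : Graph → ℕ → State → Set
RedOrPath H L t = HasCopy H red t ⊎ ∃ (BluePath t L)

module _ (H : Graph) (bip : Bipartite H) {t L n α β}
         (pα : BluePath t L α) (pβ : BluePath t n β) (apart : Apart L α β)
         (V≤L : v H ≤ L) (V≤n : v H ≤ n) where

  private
    V : ℕ
    V = v H

    side : Fin V → Bool
    side = proj₁ bip

    onSide : Bool → ℕ → Bool
    onSide true  = extend false side
    onSide false = not ∘ extend false side

    onSide-own : ∀ x → onSide (side x) (toℕ x) ≡ true
    onSide-own x with side x in sx
    ... | true  = trans (extend-toℕ x) sx
    ... | false = cong not (trans (extend-toℕ x) sx)

    rank : Fin V → ℕ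
    rank x = count (onSide (side x)) (toℕ x)

    rank-< : ∀ x → rank x < count (onSide (side x)) V
    rank-< x = count-< (onSide (side x)) (onSide-own x) (toℕ<n x)

    rank<L : ∀ x → rank x < L
    rank<L x = <-≤-trans (<-≤-trans (rank-< x) (count-≤ _ V)) V≤L

    rank<n : ∀ x → rank x < n
    rank<n x = <-≤-trans (<-≤-trans (rank-< x) (count-≤ _ V)) V≤n

    ranks : ∀ x y → side x ≡ true → side y ≡ false → suc (rank x) + suc (rank y) ≤ V
    ranks x y sx sy = begin
      suc (rank x) + suc (rank y)
        ≤⟨ +-mono-≤ (rank-< x) (rank-< y) ⟩
      count (onSide (side x)) V + count (onSide (side y)) V
        ≡⟨ cong₂ (λ c c′ → count (onSide c) V + count (onSide c′) V) sx sy ⟩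
      count (onSide true) V + count (onSide false) V
        ≡⟨ count+count-not (onSide true) V ⟩
      V ∎
      where open ≤-Reasoning

    rank-injective : ∀ {x y} → side x ≡ side y → rank x ≡ rank y → x ≡ y
    rank-injective {x} {y} sx≡sy rx≡ry = toℕ-injective
      (count-injective (onSide (side x)) (onSide-own x) y-on-side
        (trans rx≡ry (cong (λ c → count (onSide c) (toℕ y)) (≡.sym sx≡sy))))
      where
      y-on-side : onSide (side x) (toℕ y) ≡ true
      y-on-side = subst (λ c → onSide c (toℕ y) ≡ true) (≡.sym sx≡sy) (onSide-own y)

    place : Bool → ℕ → ℕ
    place true  a = L ∸ suc a
    place false b = L + b

    L∸1+a<L : ∀ {a} → a < L → L ∸ suc a < L
    L∸1+a<L = ∸-monoʳ-< (s≤s z≤n)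

    place-< : ∀ c {a} → a < L → a < n → place c a < L + n
    place-< true  a<L _   = <-≤-trans (L∸1+a<L a<L) (m≤m+n L n)
    place-< false _   a<n = +-monoʳ-< L a<n

    place-injective : ∀ c c′ {a a′} → a < L → a′ < L → place c a ≡ place c′ a′ →
                      c ≡ c′ × a ≡ a′
    place-injective true  true  a<L a′<L eq = refl , suc-injective (∸-cancelˡ-≡ a<L a′<L eq)
    place-injective true  false a<L _    eq =
      contradiction eq (<⇒≢ (<-≤-trans (L∸1+a<L a<L) (m≤m+n L _)))
    place-injective false true  _   a′<L eq =
      contradiction (≡.sym eq) (<⇒≢ (<-≤-trans (L∸1+a<L a′<L) (m≤m+n L _)))
    place-injective false false _   _    eq = refl , +-cancelˡ-≡ L _ _ eq

    position : Fin V → ℕ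
    position x = place (side x) (rank x)

    ψ : Fin V → ℕ
    ψ = join L α β ∘ position

    ψ-injective : Injective _≡_ _≡_ ψ
    ψ-injective {x} {y} =
      uncurry rank-injective ∘ place-injective (side x) (side y) (rank<L x) (rank<L y) ∘
      join-injective (injective pα) (injective pβ) apart
        (place-< (side x) (rank<L x) (rank<n x)) (place-< (side y) (rank<L y) (rank<n y))

    ψ-true : ∀ {x} → side x ≡ true → ψ x ≡ α (L ∸ suc (rank x))
    ψ-true {x} sx = trans (cong (λ c → join L α β (place c (rank x))) sx)
                          (join-< (L∸1+a<L (rank<L x)))

    ψ-false : ∀ {x} → side x ≡ false → ψ x ≡ β (rank x)
    ψ-false {x} sx = trans (cong (λ c → join L α β (place c (rank x))) sx) (join-+ L)

    cross-path : ∀ {t′ x y} → side x ≡ true → side y ≡ false → t ⊆ t′ →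
                 Coloured t′ (ψ x) (ψ y) blue → ∃ (BluePath t′ (L + (n ∸ V)))
    cross-path {t′} {x} {y} sx sy t⊆t′ xy = _ , bluePath-take
      (glue-length (rank<L x) V≤n (ranks x y sx sy))
      (bluePath-glue apart (bluePath-⊆ t⊆t′ pα) (bluePath-⊆ t⊆t′ pβ)
        (L∸1+a<L (rank<L x)) (rank<n y)
        (subst₂ (λ u w → Coloured t′ u w blue) (ψ-true sx) (ψ-false sy) xy))

    ψ-edges : List (ℕ × ℕ)
    ψ-edges = map (Product.map ψ ψ) (edges H)

    outcome : ∀ {t′} → SomeBlueOrAllRed ψ-edges t′ × t ⊆ t′ → RedOrPath H (L + (n ∸ V)) t′
    outcome {t′} (inj₂ all-red , _) = inj₁ (ψ , ψ-injective , red-edge)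
      where
      listed-red : ∀ {i j} → (i , j) ∈ edges H → Coloured t′ (ψ i) (ψ j) red
      listed-red = All.lookup (All.map⁻ all-red)
      red-edge : ∀ i j → adj H i j ≡ true → Coloured t′ (ψ i) (ψ j) red
      red-edge i j ij = [ listed-red , coloured-sym ∘ listed-red ]′ (adjacent⇒edge {H} ij)
    outcome (inj₁ some-blue , t⊆t′) with find (Any.map⁻ some-blue)
    ... | (i , j) , i,j∈ , ij-blue with edge-sides {H} bip (edge-adjacent {H} i,j∈)
    ...   | inj₁ (si , sj) = inj₂ (cross-path si sj t⊆t′ ij-blue)
    ...   | inj₂ (si , sj) = inj₂ (cross-path sj si t⊆t′ (coloured-sym ij-blue))

    ψ-edges-distinct : All (λ (a , b) → a ≢ b) ψ-edges
    ψ-edges-distinct = All.map⁺ (All.tabulate λ i,j∈ →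
      adjacent⇒≢ {H} (edge-adjacent {H} i,j∈) ∘ ψ-injective)

  forces-longer-path : Forces (RedOrPath H (L + (n ∸ v H))) (e H) t
  forces-longer-path =
    subst (λ k → Forces (RedOrPath H (L + (n ∸ V))) k t)
          (trans (length-map _ (edges H)) (length-edges H))
          (forces-map outcome (forces-extends (forces-someBlueOrAllRed ψ-edges ψ-edges-distinct t)))

-- Iterating the stages

module Growth (H : Graph) (bip : Bipartite H) {n r} (V<n : v H < n)
              (wins : BuilderWins H (P n) r []) where

  d : ℕ
  d = n ∸ v H

  FreshPath : ℕ → State → Set
  FreshPath N t = HasCopy H red t ⊎ Σ (ℕ → ℕ) λ β → BluePath t n β × (∀ j → N ≤ β j)

  forces-freshPath : ∀ {N s} → Below N s → Forces (λ t → FreshPath N t × s ⊆ t) r s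
  forces-freshPath {N} {s} below = forces-map outcome (forces-shifted below wins)
    where
    outcome : ∀ {t} → PlayedAbove H (P n) N s t → FreshPath N t × s ⊆ t
    outcome (t′ , refl , inj₁ red-H) = inj₁ (hasCopy-shift {H} red-H) , xs⊆ys++xs s _
    outcome (t′ , refl , inj₂ blue-P) =
      inj₂ (_ , bluePath-shift (copy⇒bluePath blue-P) , λ j → m≤m+n N _) , xs⊆ys++xs s _

  first-stage : Forces (RedOrPath H n) r []
  first-stage = forces-map forget-bound (forces-freshPath {N = 0} λ ())
    where
    forget-bound : ∀ {t} → FreshPath 0 t × [] ⊆ t → RedOrPath H n t
    forget-bound (inj₁ red-H , _)        = inj₁ red-H
    forget-bound (inj₂ (β , pβ , _) , _) = inj₂ (β , pβ)

  next-stage : ∀ {s L α} → v H ≤ L → BluePath s L α → Forces (RedOrPath H (L + d)) (r + e H) s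
  next-stage {s} {L} {α} V≤L pα =
    forces-bind (forces-freshPath (below-≤ (m≤m+n _ _) (below-stateBound s))) continue
    where
    N : ℕ
    N = stateBound s + pathBound L α
    continue : ∀ {t} → FreshPath N t × s ⊆ t → Forces (RedOrPath H (L + d)) (e H) t
    continue (inj₁ red-H , _) = done (inj₁ red-H)
    continue (inj₂ (β , pβ , N≤β) , s⊆t) =
      forces-longer-path H bip (bluePath-⊆ s⊆t pα) pβ
        (apart-bound (λ i<L → <-≤-trans (pathBound-> i<L) (m≤n+m _ _)) N≤β) V≤L (<⇒≤ V<n)

  stages : ∀ j → Forces (RedOrPath H (j * d + n)) (j * (r + e H) + r) []
  stages zero    = first-stage
  stages (suc j) = subst₂ (λ L k → Forces (RedOrPath H L) k [])
    (xy∙z≈zx∙y (j * d) n d) (xy∙z≈zx∙y (j * (r + e H)) r (r + e H))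
    (forces-bind (stages j) continue)
    where
    continue : ∀ {t} → RedOrPath H (j * d + n) t →
               Forces (RedOrPath H (j * d + n + d)) (r + e H) t
    continue (inj₁ red-H)    = done (inj₁ red-H)
    continue (inj₂ (α , pα)) = next-stage (≤-trans (<⇒≤ V<n) (m≤n+m n _)) pα

  rounds-bound : ∀ {m r₁} → 1 ≤ m → IsOnlineRamsey H (P m) r₁ →
                 ∀ K → m ≤ K * d → r₁ ≤ K * (r + e H)
  rounds-bound 1≤m _ zero m≤0 = contradiction (≤-trans 1≤m m≤0) λ ()
  rounds-bound {m} {r₁} _ ramsey (suc j) m≤[1+j]d = begin
    r₁                 ≤⟨ ramsey-≤ ramsey (forces⇒wins 1≤rounds (forces-map ended (stages j))) ⟩
    j * (r + e H) + r  ≡⟨ +-comm (j * (r + e H)) r ⟩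
    r + j * (r + e H)  ≤⟨ +-monoˡ-≤ (j * (r + e H)) (m≤m+n r (e H)) ⟩
    suc j * (r + e H)  ∎
    where
    open ≤-Reasoning
    1≤rounds : 1 ≤ j * (r + e H) + r
    1≤rounds = ≤-trans (wins-positive wins) (m≤n+m r _)
    m≤length : m ≤ j * d + n
    m≤length = ≤-trans m≤[1+j]d
      (≤-trans (≤-reflexive (+-comm d (j * d))) (+-monoʳ-≤ (j * d) (m∸n≤m n (v H))))
    ended : ∀ {t} → RedOrPath H (j * d + n) t → Ended H (P m) t
    ended (inj₁ red-H)    = inj₁ red-H
    ended (inj₂ (α , pα)) = inj₂ (bluePath⇒copy m≤length pα)

m≤⌈m/n⌉*n : ∀ m n .{{_ : NonZero n}} → m ≤ ⌈ m / n ⌉ * n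
m≤⌈m/n⌉*n m (suc n) = +-cancelʳ-≤ n m _ (begin
  m + n                        ≡⟨ m≡m%n+[m/n]*n (m + n) (suc n) ⟩
  (m + n) % suc n + q * suc n  ≤⟨ +-monoˡ-≤ (q * suc n) (s≤s⁻¹ (m%n<n (m + n) (suc n))) ⟩
  n + q * suc n                ≡⟨ +-comm n (q * suc n) ⟩
  q * suc n + n                ≡⟨ cong (λ x → (x ∸ 1) / suc n * suc n + n) (+-suc m n) ⟨
  ⌈ m / suc n ⌉ * suc n + n    ∎)
  where
  open ≤-Reasoning
  q = (m + n) / suc n

corollary2 : (H : Graph) → Bipartite H → (n : ℕ) → (lt : v H < n) →
    (m : ℕ) → 1 ≤ m → (r₁ r₂ : ℕ) →
    IsOnlineRamsey H (P m) r₁ → IsOnlineRamsey H (P n) r₂ →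
    r₁ ≤ ⌈ m / (n ∸ v H) ⌉ {{gap-nonZero lt}} * (r₂ + e H)
corollary2 H bip n lt m 1≤m r₁ r₂ ramsey₁ (wins₂ , _) =
  rounds-bound 1≤m ramsey₁ (⌈ m / d ⌉ {{gap-nonZero lt}}) (m≤⌈m/n⌉*n m d {{gap-nonZero lt}})
  where open Growth H bip lt wins₂
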